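{- Let $a$ be an even integer and $n$ an odd integer with $2a<n<\frac{5a}{2}$. Then every $a$-regular simple graph on $n$ vertices contains a triangle. -}

module Defs where

open import Data.Nat using (ℕ)
open import Data.Fin using (Fin)
open import Data.Bool using (Bool; true; false)
open import Data.List using (List; filterᵇ; length; allFin)
open import Data.Product using (_×_; ∃-syntax)
open import Relation.Binary.PropositionalEquality using (_≡_; _≢_)

record SimpleGraph (n : ℕ) : Set where
  field
    adj       : Fin n → Fin n → Bool
    adj-sym   : ∀ u v → adj u v ≡ adj v u
    adj-irrefl : ∀ v → adj v v ≡ false

open SimpleGraph public

degree : ∀ {n} → SimpleGraph n → Fin n → ℕ
degree G v = length (filterᵇ (adj G v) (allFin _))

IsRegular : ∀ {n} → ℕ → SimpleGraph n → Set
IsRegular a G = ∀ v → degree G v ≡ a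

-- G contains a triangle: three pairwise adjacent vertices
-- (adjacency is irreflexive, so they are automatically distinct).
HasTriangle : ∀ {n} → SimpleGraph n → Set
HasTriangle G = ∃[ u ] ∃[ v ] ∃[ w ]
  (adj G u v ≡ true × adj G v w ≡ true × adj G u w ≡ true)

{-# OPTIONS --safe #-}
module Submission where

-- Let G be triangle-free and a-regular on n vertices with 5a > 2n.  A vertex is
-- adjacent to at most two vertices of a closed walk of length 5 (two consecutive
-- ones would span a triangle), so summing degrees along such a walk gives 5a ≤ 2n:
-- G has no closed 5-walks.  Fix an edge uv.  N(u) and N(v) are disjoint and
-- |N(z)| + |N(u)| + |N(v)| = 3a > n, so every z reaches u or v by a walk of
-- length 2.  Let S be the set of vertices reaching v in two steps.  An edge inside
-- S, or inside its complement (whose vertices reach u in two steps), would close a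
-- 5-walk, so G is bipartite with parts S and ∁S.  Counting the edges of an
-- a-regular bipartite graph from both sides gives a|S| = a|∁S|, so n = 2|S|.

open import Defs
open import Data.Bool using (Bool; true; false; _∧_; _∨_; not; _≟_)
open import Data.Empty using (⊥; ⊥-elim)
open import Data.Fin using (Fin; zero; suc)
open import Data.Fin.Properties using (any?)
open import Data.List using (filterᵇ; length; tabulate)
open import Data.Nat using (ℕ; zero; suc; _+_; _*_; _≤_; _<_; z≤n; s≤s; NonZero)
open import Data.Nat.Divisibility using (_∣_; divides; _∣0)
open import Data.Nat.Properties
  using (+-*-semiring; +-identityʳ; *-identityʳ; *-zeroʳ; *-comm; *-assoc; +-mono-≤; *-monoˡ-≤;
         +-cancelˡ-<; *-cancelˡ-<; *-cancelʳ-≡; ≤-refl; ≤-reflexive; ≤-trans; <⇒≱; n≤1+n; module ≤-Reasoning)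
open import Data.Product using (_×_; _,_; ∃-syntax)
open import Data.Vec.Functional using (_∷_; [])
open import Function using (_∘_; id)
open import Relation.Binary.PropositionalEquality
open import Relation.Nullary using (¬_; Dec; yes; no; does)
open import Relation.Nullary.Decidable using (_×-dec_; decidable-stable)

open import Algebra.Properties.Semiring.Sum +-*-semiring
  using (sum; sum-syntax; sum-cong-≗; sum-replicate-zero; ∑-distrib-+; ∑-comm; *-distribˡ-sum; *-distribʳ-sum)

χ : Bool → ℕ
χ true  = 1
χ false = 0

count : ∀ {n} → (Fin n → Bool) → ℕ
count {n} p = ∑[ i < n ] χ (p i)

sum-const : ∀ n x → sum {n} (λ _ → x) ≡ n * x
sum-const zero    x = refl
sum-const (suc n) x = cong (x +_) (sum-const n x)

∑-mono-≤ : ∀ {n} {f g : Fin n → ℕ} → (∀ i → f i ≤ g i) → sum f ≤ sum g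
∑-mono-≤ {zero}  f≤g = z≤n
∑-mono-≤ {suc n} f≤g = +-mono-≤ (f≤g zero) (∑-mono-≤ (f≤g ∘ suc))

length-filterᵇ-tabulate : ∀ {A : Set} {n} (p : A → Bool) (f : Fin n → A) →
  length (filterᵇ p (tabulate f)) ≡ count (p ∘ f)
length-filterᵇ-tabulate {n = zero}  p f = refl
length-filterᵇ-tabulate {n = suc n} p f with p (f zero)
... | true  = cong suc (length-filterᵇ-tabulate p (f ∘ suc))
... | false = length-filterᵇ-tabulate p (f ∘ suc)

count≤n : ∀ {n} (p : Fin n → Bool) → count p ≤ n
count≤n {n} p = begin
  count p           ≤⟨ ∑-mono-≤ (λ i → χ≤1 (p i)) ⟩
  sum {n} (λ _ → 1) ≡⟨ sum-const n 1 ⟩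
  n * 1             ≡⟨ *-identityʳ n ⟩
  n                 ∎
  where
  open ≤-Reasoning
  χ≤1 : ∀ b → χ b ≤ 1
  χ≤1 true  = ≤-refl
  χ≤1 false = z≤n

count-pos : ∀ {n} (p : Fin n → Bool) → 0 < count p → ∃[ i ] p i ≡ true
count-pos {suc n} p 0<count with p zero in p₀
... | true  = zero , p₀
... | false = let i , pᵢ = count-pos (p ∘ suc) 0<count in suc i , pᵢ

count-complement : ∀ {n} (p : Fin n → Bool) → count p + count (not ∘ p) ≡ n
count-complement {n} p = begin
  count p + count (not ∘ p)            ≡⟨ ∑-distrib-+ (χ ∘ p) (χ ∘ not ∘ p) ⟨
  ∑[ i < n ] (χ (p i) + χ (not (p i))) ≡⟨ sum-cong-≗ (χ-complement ∘ p) ⟩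
  sum {n} (λ _ → 1)                    ≡⟨ sum-const n 1 ⟩
  n * 1                                ≡⟨ *-identityʳ n ⟩
  n                                    ∎
  where
  open ≡-Reasoning
  χ-complement : ∀ b → χ b + χ (not b) ≡ 1
  χ-complement true  = refl
  χ-complement false = refl

count-∨-∧ : ∀ {n} (p q : Fin n → Bool) →
  count (λ i → p i ∨ q i) + count (λ i → p i ∧ q i) ≡ count p + count q
count-∨-∧ {n} p q = begin
  count (λ i → p i ∨ q i) + count (λ i → p i ∧ q i)  ≡⟨ ∑-distrib-+ (λ i → χ (p i ∨ q i)) (λ i → χ (p i ∧ q i)) ⟨
  ∑[ i < n ] (χ (p i ∨ q i) + χ (p i ∧ q i))         ≡⟨ sum-cong-≗ (λ i → χ-∨-∧ (p i) (q i)) ⟩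
  ∑[ i < n ] (χ (p i) + χ (q i))                     ≡⟨ ∑-distrib-+ (χ ∘ p) (χ ∘ q) ⟩
  count p + count q                                  ∎
  where
  open ≡-Reasoning
  χ-∨-∧ : ∀ b c → χ (b ∨ c) + χ (b ∧ c) ≡ χ b + χ c
  χ-∨-∧ true  true  = refl
  χ-∨-∧ true  false = refl
  χ-∨-∧ false c     = +-identityʳ (χ c)

count-∨-disjoint : ∀ {n} (p q : Fin n → Bool) → (∀ i → p i ∧ q i ≡ false) →
  count (λ i → p i ∨ q i) ≡ count p + count q
count-∨-disjoint {n} p q disjoint = begin
  count (λ i → p i ∨ q i)                            ≡⟨ +-identityʳ _ ⟨
  count (λ i → p i ∨ q i) + 0                        ≡⟨ cong (count (λ i → p i ∨ q i) +_) count-∧≡0 ⟨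
  count (λ i → p i ∨ q i) + count (λ i → p i ∧ q i)  ≡⟨ count-∨-∧ p q ⟩
  count p + count q                                  ∎
  where
  open ≡-Reasoning
  count-∧≡0 : count (λ i → p i ∧ q i) ≡ 0
  count-∧≡0 = trans (sum-cong-≗ (cong χ ∘ disjoint)) (sum-replicate-zero n)

pigeonhole-∧ : ∀ {n} (p q : Fin n → Bool) → n < count p + count q → ∃[ i ] p i ∧ q i ≡ true
pigeonhole-∧ {n} p q n<p+q = count-pos (λ i → p i ∧ q i) (+-cancelˡ-< ∪ 0 ∩ (begin-strict
  ∪ + 0             ≡⟨ +-identityʳ ∪ ⟩
  ∪                 ≤⟨ count≤n (λ i → p i ∨ q i) ⟩
  n                 <⟨ n<p+q ⟩
  count p + count q ≡⟨ count-∨-∧ p q ⟨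
  ∪ + ∩             ∎))
  where
  open ≤-Reasoning
  ∪ ∩ : ℕ
  ∪ = count (λ i → p i ∨ q i)
  ∩ = count (λ i → p i ∧ q i)

independent-on-pentagon : ∀ b₀ b₁ b₂ b₃ b₄ →
  b₀ ∧ b₁ ≡ false → b₁ ∧ b₂ ≡ false → b₂ ∧ b₃ ≡ false → b₃ ∧ b₄ ≡ false → b₄ ∧ b₀ ≡ false →
  χ b₀ + (χ b₁ + (χ b₂ + (χ b₃ + (χ b₄ + 0)))) ≤ 2
independent-on-pentagon true  true  _     _     _     () _  _  _  _
independent-on-pentagon _     true  true  _     _     _  () _  _  _
independent-on-pentagon _     _     true  true  _     _  _  () _  _
independent-on-pentagon _     _     _     true  true  _  _  _  () _
independent-on-pentagon true  _     _     _     true  _  _  _  _  ()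
independent-on-pentagon false false false false false _ _ _ _ _ = z≤n
independent-on-pentagon true  false false false false _ _ _ _ _ = s≤s z≤n
independent-on-pentagon false true  false false false _ _ _ _ _ = s≤s z≤n
independent-on-pentagon false false true  false false _ _ _ _ _ = s≤s z≤n
independent-on-pentagon false false false true  false _ _ _ _ _ = s≤s z≤n
independent-on-pentagon false false false false true  _ _ _ _ _ = s≤s z≤n
independent-on-pentagon true  false true  false false _ _ _ _ _ = s≤s (s≤s z≤n)
independent-on-pentagon true  false false true  false _ _ _ _ _ = s≤s (s≤s z≤n)
independent-on-pentagon false true  false true  false _ _ _ _ _ = s≤s (s≤s z≤n)
independent-on-pentagon false true  false false true  _ _ _ _ _ = s≤s (s≤s z≤n)
independent-on-pentagon false false true  false true  _ _ _ _ _ = s≤s (s≤s z≤n)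

module _ {n} (G : SimpleGraph n) where

  infix 4 _~_
  _~_ : Fin n → Fin n → Set
  x ~ y = adj G x y ≡ true

  ~-sym : ∀ {x y} → x ~ y → y ~ x
  ~-sym {x} {y} x~y = trans (adj-sym G y x) x~y

  no-common-neighbour : ¬ HasTriangle G → ∀ {x y} → x ~ y → ∀ z → adj G z x ∧ adj G z y ≡ false
  no-common-neighbour triangle-free {x} {y} x~y z with adj G z x in z~x | adj G z y in z~y
  ... | true  | true  = ⊥-elim (triangle-free (z , x , y , z~x , x~y , z~y))
  ... | true  | false = refl
  ... | false | _     = refl

  TwoStep : Fin n → Fin n → Set
  TwoStep w z = ∃[ x ] (z ~ x × x ~ w)

  twoStep? : ∀ w z → Dec (TwoStep w z)
  twoStep? w z = any? λ x → (adj G z x ≟ true) ×-dec (adj G x w ≟ true)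

  triangle? : Dec (HasTriangle G)
  triangle? = any? λ u → any? λ v → any? λ w →
    (adj G u v ≟ true) ×-dec (adj G v w ≟ true) ×-dec (adj G u w ≟ true)

  module _ {a} (regular : IsRegular a G) where

    count-adj : ∀ v → count (adj G v) ≡ a
    count-adj v = trans (sym (length-filterᵇ-tabulate (adj G v) id)) (regular v)

    count-adjᵀ : ∀ v → count (λ x → adj G x v) ≡ a
    count-adjᵀ v = trans (sum-cong-≗ (λ x → cong χ (adj-sym G x v))) (count-adj v)

    regular-bipartite⇒even : .{{NonZero a}} → (side : Fin n → Bool) →
      (∀ {x y} → x ~ y → side x ≡ not (side y)) → 2 ∣ n
    regular-bipartite⇒even side crossing = divides (count side) (begin
      n                                ≡⟨ count-complement side ⟨
      count side + count (not ∘ side)  ≡⟨ cong (count side +_) balanced ⟨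
      count side + count side          ≡⟨ cong (count side +_) (+-identityʳ _) ⟨
      2 * count side                   ≡⟨ *-comm 2 (count side) ⟩
      count side * 2                   ∎)
      where
      open ≡-Reasoning
      edge-term : ∀ x y → χ (side x) * χ (adj G x y) ≡ χ (not (side y)) * χ (adj G x y)
      edge-term x y with adj G x y in x~y
      ... | true  = cong (λ b → χ b * 1) (crossing x~y)
      ... | false = trans (*-zeroʳ (χ (side x))) (sym (*-zeroʳ (χ (not (side y)))))
      balanced : count side ≡ count (not ∘ side)
      balanced = *-cancelʳ-≡ _ _ a (begin
        count side * a
          ≡⟨ *-distribʳ-sum a (χ ∘ side) ⟩
        ∑[ x < n ] (χ (side x) * a)
          ≡⟨ sum-cong-≗ (λ x → cong (χ (side x) *_) (count-adj x)) ⟨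
        ∑[ x < n ] (χ (side x) * count (adj G x))
          ≡⟨ sum-cong-≗ (λ x → *-distribˡ-sum (χ (side x)) (χ ∘ adj G x)) ⟩
        ∑[ x < n ] ∑[ y < n ] (χ (side x) * χ (adj G x y))
          ≡⟨ sum-cong-≗ (λ x → sum-cong-≗ (edge-term x)) ⟩
        ∑[ x < n ] ∑[ y < n ] (χ (not (side y)) * χ (adj G x y))
          ≡⟨ ∑-comm (λ x y → χ (not (side y)) * χ (adj G x y)) ⟩
        ∑[ y < n ] ∑[ x < n ] (χ (not (side y)) * χ (adj G x y))
          ≡⟨ sum-cong-≗ (λ y → *-distribˡ-sum (χ (not (side y))) (λ x → χ (adj G x y))) ⟨
        ∑[ y < n ] (χ (not (side y)) * count (λ x → adj G x y))
          ≡⟨ sum-cong-≗ (λ y → cong (χ (not (side y)) *_) (count-adjᵀ y)) ⟩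
        ∑[ y < n ] (χ (not (side y)) * a)
          ≡⟨ *-distribʳ-sum a (χ ∘ not ∘ side) ⟨
        count (not ∘ side) * a
          ∎)

    module _ (triangle-free : ¬ HasTriangle G) where

      closed-5-walk-bound : ∀ {c₀ c₁ c₂ c₃ c₄} →
        c₀ ~ c₁ → c₁ ~ c₂ → c₂ ~ c₃ → c₃ ~ c₄ → c₄ ~ c₀ → 5 * a ≤ n * 2
      closed-5-walk-bound {c₀} {c₁} {c₂} {c₃} {c₄} c₀₁ c₁₂ c₂₃ c₃₄ c₄₀ = begin
        5 * a                                     ≡⟨ sum-cong-≗ (count-adjᵀ ∘ c) ⟨
        ∑[ i < 5 ] count (λ z → adj G z (c i))    ≡⟨ ∑-comm (λ i z → χ (adj G z (c i))) ⟩
        ∑[ z < n ] ∑[ i < 5 ] χ (adj G z (c i))   ≤⟨ ∑-mono-≤ at-most-two ⟩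
        sum {n} (λ _ → 2)                         ≡⟨ sum-const n 2 ⟩
        n * 2                                     ∎
        where
        open ≤-Reasoning
        c : Fin 5 → Fin n
        c = c₀ ∷ c₁ ∷ c₂ ∷ c₃ ∷ c₄ ∷ []
        at-most-two : ∀ z → ∑[ i < 5 ] χ (adj G z (c i)) ≤ 2
        at-most-two z = independent-on-pentagon (adj G z c₀) (adj G z c₁) (adj G z c₂) (adj G z c₃) (adj G z c₄)
          (no-common-neighbour triangle-free c₀₁ z) (no-common-neighbour triangle-free c₁₂ z)
          (no-common-neighbour triangle-free c₂₃ z) (no-common-neighbour triangle-free c₃₄ z)
          (no-common-neighbour triangle-free c₄₀ z)

      module _ (dense : 2 * n < 5 * a) where

        two-step-independent : ∀ {w y z} → y ~ z → TwoStep w y → TwoStep w z → ⊥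
        two-step-independent y~z (x , y~x , x~w) (x′ , z~x′ , x′~w) =
          <⇒≱ dense (≤-trans (closed-5-walk-bound y~x x~w (~-sym x′~w) (~-sym z~x′) (~-sym y~z))
                             (≤-reflexive (*-comm n 2)))

        neighbourhoods-overlap : ∀ {u v} → u ~ v → ∀ z →
          n < count (adj G z) + count (λ x → adj G x v ∨ adj G x u)
        neighbourhoods-overlap {u} {v} u~v z = begin-strict
          n                       <⟨ *-cancelˡ-< 2 n (a + (a + a)) 2n<6a ⟩
          a + (a + a)             ≡⟨ cong₂ _+_ (count-adj z) (cong₂ _+_ (count-adjᵀ v) (count-adjᵀ u)) ⟨
          count (adj G z) + (count (λ x → adj G x v) + count (λ x → adj G x u))
            ≡⟨ cong (count (adj G z) +_) (count-∨-disjoint _ _ (no-common-neighbour triangle-free (~-sym u~v))) ⟨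
          count (adj G z) + count (λ x → adj G x v ∨ adj G x u) ∎
          where
          open ≤-Reasoning
          2n<6a : 2 * n < 2 * (a + (a + a))
          2n<6a = begin-strict
            2 * n             <⟨ dense ⟩
            5 * a             ≤⟨ *-monoˡ-≤ a (n≤1+n 5) ⟩
            6 * a             ≡⟨ *-assoc 2 3 a ⟩
            2 * (3 * a)       ≡⟨ cong (λ t → 2 * (a + (a + t))) (+-identityʳ a) ⟩
            2 * (a + (a + a)) ∎

        two-step-cover : ∀ {u v} → u ~ v → ∀ z → ¬ TwoStep v z → TwoStep u z
        two-step-cover {u} {v} u~v z ¬TwoStep-v
          with pigeonhole-∧ (adj G z) (λ x → adj G x v ∨ adj G x u) (neighbourhoods-overlap u~v z)
        ... | x , z~x∧[x~v∨x~u] with adj G z x in z~x | adj G x v in x~v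
        ...   | true | true  = ⊥-elim (¬TwoStep-v (x , z~x , x~v))
        ...   | true | false = x , z~x , z~x∧[x~v∨x~u]   -- now reduced to x ~ u

        edge⇒even : .{{NonZero a}} → ∀ {u v} → u ~ v → 2 ∣ n
        edge⇒even {u} {v} u~v = regular-bipartite⇒even side crossing
          where
          side : Fin n → Bool
          side z = does (twoStep? v z)
          crossing : ∀ {y z} → y ~ z → side y ≡ not (side z)
          crossing {y} {z} y~z with twoStep? v y | twoStep? v z
          ... | yes v⋯y | yes v⋯z = ⊥-elim (two-step-independent y~z v⋯y v⋯z)
          ... | yes _   | no _    = refl
          ... | no _    | yes _   = refl
          ... | no ¬v⋯y | no ¬v⋯z = ⊥-elim (two-step-independent y~z
                                      (two-step-cover u~v y ¬v⋯y) (two-step-cover u~v z ¬v⋯z))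

triangle-free-regular-dense⇒even : ∀ {n a} (G : SimpleGraph n) → ¬ HasTriangle G → IsRegular a G →
  2 * n < 5 * a → 2 ∣ n
triangle-free-regular-dense⇒even {zero}          G _             _       _     = 2 ∣0
triangle-free-regular-dense⇒even {suc n} {zero}  G _             _       ()
triangle-free-regular-dense⇒even {suc n} {suc a} G triangle-free regular dense
  with count-pos (adj G zero) (subst (0 <_) (sym (count-adj G regular zero)) (s≤s z≤n))
... | _ , 0~u = edge⇒even G regular triangle-free dense (~-sym G 0~u)

lemma14 : (a n : ℕ) → 2 ∣ a → ¬ (2 ∣ n) → 2 * a < n → 2 * n < 5 * a →
    (G : SimpleGraph n) → IsRegular a G → HasTriangle G
lemma14 a n _ n-odd _ dense G regular = decidable-stable (triangle? G)
  λ triangle-free → n-odd (triangle-free-regular-dense⇒even G triangle-free regular dense)
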